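{- The class of line graphs has the strong Erdős–Hajnal property: there exists $\delta>0$ such that every line graph $G$ with at least two vertices has a homogeneous pair $(P,Q)$ with $|P|,|Q|\geq \delta|V(G)|$.
   Context: A multigraph is a vertex set together with a multiset of edges, each edge an unordered pair of distinct vertices. The line graph $L(H)$ of a multigraph $H$ has vertex set $E(H)$ (the edges, counted with multiplicity), two of them adjacent iff they share an endpoint in $H$. A line graph is a graph isomorphic to $L(H)$ for some (multi)graph $H$. For disjoint vertex sets $P,Q$, $(P,Q)$ is a homogeneous pair if either all edges between $P$ and $Q$ are present or none are. -}

module Defs where

open import Data.Nat using (ℕ)
open import Data.Bool using (Bool; true; false)
open import Data.Fin using (Fin)
open import Data.Fin.Subset using (Subset; _∈_)
open import Data.Product using (_×_; Σ; ∃)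
open import Data.Sum using (_⊎_)
open import Data.Empty using (⊥)
open import Relation.Nullary using (¬_)
open import Relation.Binary.PropositionalEquality using (_≡_)

record SimpleGraph (n : ℕ) : Set where
  field
    adj   : Fin n → Fin n → Bool
    sym   : ∀ i j → adj i j ≡ adj j i
    irrefl : ∀ i → adj i i ≡ false
open SimpleGraph public

record Multigraph (m n : ℕ) : Set where
  field
    end₁ end₂ : Fin n → Fin m
    loopless  : ∀ e → ¬ (end₁ e ≡ end₂ e)
open Multigraph public

ShareEnd : ∀ {m n} → Multigraph m n → Fin n → Fin n → Set
ShareEnd H e f =
  (end₁ H e ≡ end₁ H f) ⊎ (end₁ H e ≡ end₂ H f) ⊎
  (end₂ H e ≡ end₁ H f) ⊎ (end₂ H e ≡ end₂ H f)

-- G is a line graph: G ≅ L(H) for some multigraph H. Since the vertex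
-- set of L(H) is E(H), an isomorphism amounts to indexing the edges of H
-- by the vertices of G so that distinct vertices are adjacent iff the
-- corresponding edges share an endpoint.
IsLineGraph : ∀ {n} → SimpleGraph n → Set
IsLineGraph {n} G =
  Σ ℕ λ m → Σ (Multigraph m n) λ H →
    ∀ i j → ¬ (i ≡ j) → (adj G i j ≡ true → ShareEnd H i j) × (ShareEnd H i j → adj G i j ≡ true)

IsHomogeneousPair : ∀ {n} → SimpleGraph n → Subset n → Subset n → Set
IsHomogeneousPair G P Q =
  (∀ i → i ∈ P → i ∈ Q → ⊥) ×
  ((∀ i j → i ∈ P → j ∈ Q → adj G i j ≡ true) ⊎
   (∀ i j → i ∈ P → j ∈ Q → adj G i j ≡ false))

-- Let G = L(H). If some vertex of H meets more than 2k edges, these edges are pairwise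
-- adjacent in G, and splitting them in two gives a complete pair of size k. Otherwise every
-- vertex meets at most 2k edges. Order the vertices of H; moving a threshold past one vertex
-- then changes the number of edges on either side by at most 2k, so thresholds can cut off
-- prescribed numbers of edges up to an error of 2k. Edges spanned by a vertex set S and edges
-- spanned by its complement are anticomplete in G. Cut at t so that between k and 3k edges
-- lie below t: either at least k edges lie above t, or at least 8k edges cross t. The crossing
-- edges are cut by their lower end at s (between 4k and 6k of them reach below s) and those
-- again by their upper end at r; one of the two diagonal quadrants then gives an anticomplete
-- pair. So n ≥ 12k edges yield a homogeneous pair of size k, and k = ⌊n/12⌋ (or two
-- singletons when n < 12) gives δ = 1/24.

module Submission where

module Counting where

  open import Data.Fin using (Fin; toℕ; fromℕ<)
  import Data.Fin.Properties as Finₚ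
  open import Data.Fin.Subset using (Subset; inside; outside; _∈_; _⊆_; _∪_; ∣_∣; ⁅_⁆)
    renaming (⊤ to full; ⊥ to ∅)
  open import Data.Fin.Subset.Properties
    using (p⊆q⇒∣p∣≤∣q∣; x∈p∪q⁺; ∣⊤∣≡n; ∣⊥∣≡0; ∣p∣≤∣x∷p∣; ∣⁅x⁆∣≡1; x∈⁅x⁆)
  open import Data.Nat using (ℕ; zero; suc; _+_; _≤_; _<_; z≤n; s≤s; _≤?_; _<?_; _≟_)
  open import Data.Nat.Properties
  open import Data.Product using (_×_; _,_; ∃-syntax)
  open import Data.Sum using (inj₁; inj₂)
  open import Data.Vec using ([]; _∷_; tabulate)
  open import Data.Vec.Properties using (lookup∘tabulate; []=⇒lookup; lookup⇒[]=)
  open import Function using (_∘_)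
  open import Level using (Level)
  open import Relation.Binary.PropositionalEquality using (_≡_; _≢_; sym; trans; subst)
  open import Relation.Nullary using (¬_; yes; no; does; contradiction)
  open import Relation.Nullary.Decidable using (dec-true)
  open import Relation.Unary using (Pred; Decidable; _∩_)
  open import Relation.Unary.Properties using (_∩?_; ∁?)

  private variable
    ℓ ℓ′ : Level
    n : ℕ

  subset : {P : Pred (Fin n) ℓ} → Decidable P → Subset n
  subset P? = tabulate (does ∘ P?)

  module _ {P : Pred (Fin n) ℓ} (P? : Decidable P) where

    ∈-subset⁺ : ∀ {i} → P i → i ∈ subset P?
    ∈-subset⁺ {i} Pi =
      lookup⇒[]= i (subset P?) (trans (lookup∘tabulate (does ∘ P?) i) (dec-true (P? i) Pi))

    ∈-subset⁻ : ∀ {i} → i ∈ subset P? → P i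
    ∈-subset⁻ {i} i∈ with P? i | trans (sym (lookup∘tabulate (does ∘ P?) i)) ([]=⇒lookup i∈)
    ... | yes Pi | _  = Pi
    ... | no  _  | ()

    ∣subset∣≡0 : (∀ i → ¬ P i) → ∣ subset P? ∣ ≡ 0
    ∣subset∣≡0 ¬P = n≤0⇒n≡0 (subst (∣ subset P? ∣ ≤_) (∣⊥∣≡0 n)
      (p⊆q⇒∣p∣≤∣q∣ {q = ∅} (λ i∈ → contradiction (∈-subset⁻ i∈) (¬P _))))

    n≤∣subset∣ : (∀ i → P i) → n ≤ ∣ subset P? ∣
    n≤∣subset∣ allP =
      subst (_≤ ∣ subset P? ∣) (∣⊤∣≡n _) (p⊆q⇒∣p∣≤∣q∣ {p = full} (λ _ → ∈-subset⁺ (allP _)))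

  ∣p∪q∣≤∣p∣+∣q∣ : (p q : Subset n) → ∣ p ∪ q ∣ ≤ ∣ p ∣ + ∣ q ∣
  ∣p∪q∣≤∣p∣+∣q∣ []            []      = z≤n
  ∣p∪q∣≤∣p∣+∣q∣ (outside ∷ p) (outside ∷ q) = ∣p∪q∣≤∣p∣+∣q∣ p q
  ∣p∪q∣≤∣p∣+∣q∣ (outside ∷ p) (inside ∷ q) =
    subst (suc ∣ p ∪ q ∣ ≤_) (sym (+-suc ∣ p ∣ ∣ q ∣)) (s≤s (∣p∪q∣≤∣p∣+∣q∣ p q))
  ∣p∪q∣≤∣p∣+∣q∣ (inside ∷ p)  (x ∷ q) =
    s≤s (≤-trans (∣p∪q∣≤∣p∣+∣q∣ p q) (+-monoʳ-≤ ∣ p ∣ (∣p∣≤∣x∷p∣ x q)))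

  p⊆q∪r⇒∣p∣≤∣q∣+∣r∣ : {p q r : Subset n} → p ⊆ q ∪ r → ∣ p ∣ ≤ ∣ q ∣ + ∣ r ∣
  p⊆q∪r⇒∣p∣≤∣q∣+∣r∣ {q = q} {r} p⊆q∪r = ≤-trans (p⊆q⇒∣p∣≤∣q∣ p⊆q∪r) (∣p∪q∣≤∣p∣+∣q∣ q r)

  m+n≤o+p⇒o≤m⇒n≤p : ∀ {m n o p} → m + n ≤ o + p → o ≤ m → n ≤ p
  m+n≤o+p⇒o≤m⇒n≤p {m} {n} {o} {p} m+n≤o+p o≤m =
    +-cancelˡ-≤ m n p (≤-trans m+n≤o+p (+-monoˡ-≤ p o≤m))

  module _ {P : Pred (Fin n) ℓ} {Q : Pred (Fin n) ℓ′} (P? : Decidable P) (Q? : Decidable Q) where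

    ∣subset∣-split : ∣ subset P? ∣ ≤ ∣ subset (P? ∩? Q?) ∣ + ∣ subset (P? ∩? ∁? Q?) ∣
    ∣subset∣-split = p⊆q∪r⇒∣p∣≤∣q∣+∣r∣ split
      where
      split : subset P? ⊆ subset (P? ∩? Q?) ∪ subset (P? ∩? ∁? Q?)
      split {i} i∈ with Q? i
      ... | yes Qi = x∈p∪q⁺ (inj₁ (∈-subset⁺ (P? ∩? Q?) (∈-subset⁻ P? i∈ , Qi)))
      ... | no ¬Qi = x∈p∪q⁺ (inj₂ (∈-subset⁺ (P? ∩? ∁? Q?) (∈-subset⁻ P? i∈ , ¬Qi)))

    ∣subset-∩∁∣-lower : ∀ {x y} → x + y ≤ ∣ subset P? ∣ → ∣ subset (P? ∩? Q?) ∣ ≤ x →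
                        y ≤ ∣ subset (P? ∩? ∁? Q?) ∣
    ∣subset-∩∁∣-lower x+y≤∣P∣ = m+n≤o+p⇒o≤m⇒n≤p (≤-trans x+y≤∣P∣ ∣subset∣-split)

    ∣subset-∩∣-lower : ∀ {x y} → x + y ≤ ∣ subset P? ∣ → ∣ subset (P? ∩? ∁? Q?) ∣ ≤ x →
                       y ≤ ∣ subset (P? ∩? Q?) ∣
    ∣subset-∩∣-lower x+y≤∣P∣ = m+n≤o+p⇒o≤m⇒n≤p
      (≤-trans x+y≤∣P∣ (≤-trans ∣subset∣-split (≤-reflexive (+-comm ∣ subset (P? ∩? Q?) ∣ _))))

  ∣toℕ-fibre∣≤1 : ∀ t → ∣ subset (λ (i : Fin n) → toℕ i ≟ t) ∣ ≤ 1
  ∣toℕ-fibre∣≤1 {n} t with t <? n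
  ... | yes t<n = ≤-trans (p⊆q⇒∣p∣≤∣q∣ fibre⊆⁅j⁆) (≤-reflexive (∣⁅x⁆∣≡1 j))
    where
    j : Fin n
    j = fromℕ< t<n
    fibre⊆⁅j⁆ : subset (λ (i : Fin n) → toℕ i ≟ t) ⊆ ⁅ j ⁆
    fibre⊆⁅j⁆ {i} i∈ = subst (_∈ ⁅ j ⁆) (sym (Finₚ.toℕ-injective
      (trans (∈-subset⁻ (λ i → toℕ i ≟ t) i∈) (sym (Finₚ.toℕ-fromℕ< t<n))))) (x∈⁅x⁆ j)
  ... | no t≮n = ≤-trans (≤-reflexive (∣subset∣≡0 (λ i → toℕ i ≟ t) empty)) z≤n
    where
    empty : ∀ i → toℕ i ≢ t
    empty i i≡t = t≮n (subst (_< n) i≡t (Finₚ.toℕ<n i))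

  discrete-ivt : (f : ℕ → ℕ) {T Δ : ℕ} (M : ℕ) → f 0 ≤ T → T ≤ f M →
                 (∀ t → f (suc t) ≤ f t + Δ) → ∃[ t ] T ≤ f t × f t ≤ T + Δ
  discrete-ivt f {T} {Δ} zero    f0≤T T≤fM step = 0 , T≤fM , ≤-trans f0≤T (m≤m+n T Δ)
  discrete-ivt f {T} {Δ} (suc M) f0≤T T≤fM step with T ≤? f M
  ... | yes T≤fM′ = discrete-ivt f M f0≤T T≤fM′ step
  ... | no  T≰fM′ = suc M , T≤fM , ≤-trans (step M) (+-monoˡ-≤ Δ (<⇒≤ (≰⇒> T≰fM′)))

  module _ {P : Pred (Fin n) ℓ} (P? : Decidable P) (key : Fin n → ℕ) where

    below? : ∀ t → Decidable (P ∩ (λ i → key i < t))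
    below? t = P? ∩? (λ i → key i <? t)

    below : ℕ → Subset n
    below t = subset (below? t)

    sweep : {Δ M : ℕ} (T : ℕ) → (∀ t → ∣ subset (λ i → key i ≟ t) ∣ ≤ Δ) →
            (∀ {i} → P i → key i < M) → T ≤ ∣ subset P? ∣ →
            ∃[ t ] T ≤ ∣ below t ∣ × ∣ below t ∣ ≤ T + Δ
    sweep {Δ} {M} T fibre≤Δ key<M T≤∣P∣ = discrete-ivt (λ t → ∣ below t ∣) M
      (≤-trans (≤-reflexive (∣subset∣≡0 (below? 0) (λ { _ (_ , ()) }))) z≤n)
      (≤-trans T≤∣P∣ (p⊆q⇒∣p∣≤∣q∣ P⊆below))
      step
      where
      P⊆below : subset P? ⊆ below M
      P⊆below i∈ = let Pi = ∈-subset⁻ P? i∈ in ∈-subset⁺ (below? M) (Pi , key<M Pi)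
      step : ∀ t → ∣ below (suc t) ∣ ≤ ∣ below t ∣ + Δ
      step t = ≤-trans (p⊆q∪r⇒∣p∣≤∣q∣+∣r∣ cover) (+-monoʳ-≤ ∣ below t ∣ (fibre≤Δ t))
        where
        cover : below (suc t) ⊆ below t ∪ subset (λ i → key i ≟ t)
        cover i∈ with ∈-subset⁻ (below? (suc t)) i∈
        ... | Pi , k<1+t with m<1+n⇒m<n∨m≡n k<1+t
        ...   | inj₁ k<t = x∈p∪q⁺ (inj₁ (∈-subset⁺ (below? t) (Pi , k<t)))
        ...   | inj₂ k≡t = x∈p∪q⁺ (inj₂ (∈-subset⁺ (λ i → key i ≟ t) k≡t))

module HomogeneousPairs where

  open import Data.Bool using (true; false)
  open import Data.Bool.Properties using (¬-not)
  open import Data.Empty using (⊥; ⊥-elim)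
  open import Data.Fin as Fin using (Fin; toℕ)
  import Data.Fin.Properties as Finₚ
  open import Data.Fin.Subset using (Subset; _∈_; _⊆_; ∣_∣; ⁅_⁆)
  open import Data.Fin.Subset.Properties using (p⊆q⇒∣p∣≤∣q∣; ∣⁅x⁆∣≡1; x∈⁅y⁆⇒x≡y)
  open import Data.Integer as ℤ using (+_)
  import Data.Integer.Properties as ℤₚ
  open import Data.Nat using (ℕ; zero; suc; _+_; _*_; _⊓_; _⊔_; _≤_; _<_; z≤n; s≤s; _≤?_; _<?_; _≟_)
  open import Data.Nat.DivMod using (_/_; m≡m%n+[m/n]*n; m%n<n; m/n*n≤m; m/n≡0⇒m<n)
  open import Data.Nat.Properties
  open import Data.Nat.Tactic.RingSolver using (solve-∀)
  open import Data.Product using (_×_; _,_; proj₁; proj₂; ∃-syntax)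
  import Data.Rational as ℚ
  import Data.Rational.Properties as ℚₚ
  import Data.Rational.Unnormalised as ℚᵘ
  import Data.Rational.Unnormalised.Properties as ℚᵘₚ
  open import Data.Sum using (_⊎_; inj₁; inj₂; [_,_]′)
  import Data.Sum as Sum
  open import Data.Unit using (tt)
  open import Function using (_∘_)
  open import Level using (Level; 0ℓ)
  open import Relation.Binary.PropositionalEquality using (_≡_; _≢_; refl; sym; trans; cong; subst; subst₂)
  open import Relation.Nullary using (¬_; yes; no)
  open import Relation.Nullary.Decidable using (_⊎-dec_)
  open import Relation.Unary using (Pred; Decidable; U; _∩_; ∁)
  open import Relation.Unary.Properties using (U?; _∩?_; ∁?)
  open import Defs hiding (sym)
  open Counting

  private variable
    ℓ : Level
    n : ℕ

  HomogeneousPairOfSize : SimpleGraph n → ℕ → Set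
  HomogeneousPairOfSize {n} G k =
    ∃[ P ] ∃[ Q ] IsHomogeneousPair {n} G P Q × k ≤ ∣ P ∣ × k ≤ ∣ Q ∣

  module LineGraph {m n} (H : Multigraph m n) (G : SimpleGraph n)
    (isLine : ∀ i j → i ≢ j →
                (adj G i j ≡ true → ShareEnd H i j) × (ShareEnd H i j → adj G i j ≡ true))
    where

    rank₁ rank₂ lo hi : Fin n → ℕ
    rank₁ e = toℕ (end₁ H e)
    rank₂ e = toℕ (end₂ H e)
    lo e = rank₁ e ⊓ rank₂ e
    hi e = rank₁ e ⊔ rank₂ e

    Incident : ℕ → Pred (Fin n) 0ℓ
    Incident v e = rank₁ e ≡ v ⊎ rank₂ e ≡ v

    incident? : ∀ v → Decidable (Incident v)
    incident? v e = rank₁ e ≟ v ⊎-dec rank₂ e ≟ v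

    star : ℕ → Subset n
    star v = subset (incident? v)

    Within : Pred ℕ ℓ → Pred (Fin n) ℓ
    Within S e = S (rank₁ e) × S (rank₂ e)

    incident⇒<m : ∀ {v e} → Incident v e → v < m
    incident⇒<m (inj₁ refl) = Finₚ.toℕ<n _
    incident⇒<m (inj₂ refl) = Finₚ.toℕ<n _

    lo-incident : ∀ e → Incident (lo e) e
    lo-incident e = Sum.map sym sym (⊓-sel (rank₁ e) (rank₂ e))

    hi-incident : ∀ e → Incident (hi e) e
    hi-incident e = Sum.map sym sym (⊔-sel (rank₁ e) (rank₂ e))

    hi<m : ∀ e → hi e < m
    hi<m e = incident⇒<m (hi-incident e)

    within-lo-hi : ∀ (S : Pred ℕ ℓ) {e} → S (lo e) → S (hi e) → Within S e
    within-lo-hi S {e} S-lo S-hi with ≤-total (rank₁ e) (rank₂ e)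
    ... | inj₁ r₁≤r₂ = subst S (m≤n⇒m⊓n≡m r₁≤r₂) S-lo , subst S (m≤n⇒m⊔n≡n r₁≤r₂) S-hi
    ... | inj₂ r₂≤r₁ = subst S (m≥n⇒m⊔n≡m r₂≤r₁) S-hi , subst S (m≥n⇒m⊓n≡n r₂≤r₁) S-lo

    within-incident : ∀ (S : Pred ℕ ℓ) {v e} → Within S e → Incident v e → S v
    within-incident S (S₁ , _) (inj₁ refl) = S₁
    within-incident S (_ , S₂) (inj₂ refl) = S₂

    shareEnd⇒incident : ∀ {i j} → ShareEnd H i j → ∃[ v ] Incident v i × Incident v j
    shareEnd⇒incident (inj₁ eq)               = _ , inj₁ refl , inj₁ (sym (cong toℕ eq))
    shareEnd⇒incident (inj₂ (inj₁ eq))        = _ , inj₁ refl , inj₂ (sym (cong toℕ eq))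
    shareEnd⇒incident (inj₂ (inj₂ (inj₁ eq))) = _ , inj₂ refl , inj₁ (sym (cong toℕ eq))
    shareEnd⇒incident (inj₂ (inj₂ (inj₂ eq))) = _ , inj₂ refl , inj₂ (sym (cong toℕ eq))

    incident⇒shareEnd : ∀ {v i j} → Incident v i → Incident v j → ShareEnd H i j
    incident⇒shareEnd (inj₁ a) (inj₁ b) = inj₁ (Finₚ.toℕ-injective (trans a (sym b)))
    incident⇒shareEnd (inj₁ a) (inj₂ b) = inj₂ (inj₁ (Finₚ.toℕ-injective (trans a (sym b))))
    incident⇒shareEnd (inj₂ a) (inj₁ b) = inj₂ (inj₂ (inj₁ (Finₚ.toℕ-injective (trans a (sym b)))))
    incident⇒shareEnd (inj₂ a) (inj₂ b) = inj₂ (inj₂ (inj₂ (Finₚ.toℕ-injective (trans a (sym b)))))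

    within-homogeneous : ∀ (S : Pred ℕ ℓ) {p q : Subset n} →
      (∀ {e} → e ∈ p → Within S e) → (∀ {e} → e ∈ q → Within (∁ S) e) →
      IsHomogeneousPair G p q
    within-homogeneous S {p} {q} p⊆S q⊆∁S = disjoint , inj₂ nonadjacent
      where
      disjoint : ∀ e → e ∈ p → e ∈ q → ⊥
      disjoint e e∈p e∈q = proj₁ (q⊆∁S e∈q) (proj₁ (p⊆S e∈p))
      nonadjacent : ∀ i j → i ∈ p → j ∈ q → adj G i j ≡ false
      nonadjacent i j i∈p j∈q = ¬-not adj≢true
        where
        adj≢true : adj G i j ≢ true
        adj≢true adj≡true with i Fin.≟ j
        ... | yes refl = disjoint i i∈p j∈q
        ... | no i≢j with shareEnd⇒incident (proj₁ (isLine i j i≢j) adj≡true)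
        ...   | _ , v∈i , v∈j =
          within-incident (∁ S) (q⊆∁S j∈q) v∈j (within-incident S (p⊆S i∈p) v∈i)

    star-homogeneous : ∀ v {p q : Subset n} →
      (∀ {e} → e ∈ p → Incident v e) → (∀ {e} → e ∈ q → Incident v e) →
      (∀ e → e ∈ p → e ∈ q → ⊥) → IsHomogeneousPair G p q
    star-homogeneous v {p} {q} p⊆star q⊆star disjoint = disjoint , inj₁ adjacent
      where
      adjacent : ∀ i j → i ∈ p → j ∈ q → adj G i j ≡ true
      adjacent i j i∈p j∈q with i Fin.≟ j
      ... | yes refl = ⊥-elim (disjoint i i∈p j∈q)
      ... | no i≢j = proj₂ (isLine i j i≢j) (incident⇒shareEnd (p⊆star i∈p) (q⊆star j∈q))

    rank-fibre⊆star : ∀ (rank : Fin n → ℕ) → (∀ e → Incident (rank e) e) →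
      ∀ v → subset (λ e → rank e ≟ v) ⊆ star v
    rank-fibre⊆star rank rank-incident v e∈ with ∈-subset⁻ (λ e → rank e ≟ v) e∈
    ... | refl = ∈-subset⁺ (incident? v) (rank-incident _)

    high-or-bounded-degree : ∀ d → (∃[ v ] d < ∣ star v ∣) ⊎ (∀ v → ∣ star v ∣ ≤ d)
    high-or-bounded-degree d with anyUpTo? (λ v → d <? ∣ star v ∣) m
    ... | yes (v , _ , d<deg) = inj₁ (v , d<deg)
    ... | no ∄v = inj₂ deg≤d
      where
      deg≤d : ∀ v → ∣ star v ∣ ≤ d
      deg≤d v with v <? m
      ... | yes v<m = ≮⇒≥ (λ d<deg → ∄v (v , v<m , d<deg))
      ... | no v≮m = subst (_≤ d) (sym (∣subset∣≡0 (incident? v) (λ _ → v≮m ∘ incident⇒<m))) z≤n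

    star-pair : ∀ k v → 2 * k < ∣ star v ∣ → HomogeneousPairOfSize G k
    star-pair k v 2k<deg with sweep (incident? v) toℕ k (∣toℕ-fibre∣≤1 {n}) (λ {e} _ → Finₚ.toℕ<n e)
                                    (≤-trans (m≤m+n k _) (<⇒≤ 2k<deg))
    ... | i , k≤∣first∣ , ∣first∣≤k+1 =
      _ , _ , star-homogeneous v (proj₁ ∘ ∈-subset⁻ first?) (proj₁ ∘ ∈-subset⁻ rest?) disjoint ,
      k≤∣first∣ ,
      ∣subset-∩∁∣-lower (incident? v) index<? (≤-trans (≤-reflexive (k+1+k≡1+2k k)) 2k<deg) ∣first∣≤k+1
      where
      index<? : Decidable (λ e → toℕ e < i)
      index<? e = toℕ e <? i
      first? : Decidable (Incident v ∩ (λ e → toℕ e < i))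
      first? = incident? v ∩? index<?
      rest? : Decidable (Incident v ∩ ∁ (λ e → toℕ e < i))
      rest? = incident? v ∩? ∁? index<?
      disjoint : ∀ e → e ∈ subset first? → e ∈ subset rest? → ⊥
      disjoint e e∈first e∈rest = proj₂ (∈-subset⁻ rest? e∈rest) (proj₂ (∈-subset⁻ first? e∈first))
      k+1+k≡1+2k : ∀ k → k + 1 + k ≡ suc (2 * k)
      k+1+k≡1+2k = solve-∀

    HiBelow LoBelow : ℕ → Pred (Fin n) 0ℓ
    HiBelow t e = hi e < t
    LoBelow t e = lo e < t

    hiBelow? : ∀ t → Decidable (HiBelow t)
    hiBelow? t e = hi e <? t

    loBelow? : ∀ t → Decidable (LoBelow t)
    loBelow? t e = lo e <? t

    -- The factor U makes subset (upper? t) the second part of the split of subset U? by hiBelow? t.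
    Upper Crossing Above : ℕ → Pred (Fin n) 0ℓ
    Upper t = U ∩ ∁ (HiBelow t)
    Crossing t = Upper t ∩ LoBelow t
    Above t = Upper t ∩ ∁ (LoBelow t)

    upper? : ∀ t → Decidable (Upper t)
    upper? t = U? ∩? ∁? (hiBelow? t)

    crossing? : ∀ t → Decidable (Crossing t)
    crossing? t = upper? t ∩? loBelow? t

    above? : ∀ t → Decidable (Above t)
    above? t = upper? t ∩? ∁? (loBelow? t)

    below-above-homogeneous : ∀ t → IsHomogeneousPair G (below U? hi t) (subset (above? t))
    below-above-homogeneous t = within-homogeneous (_< t)
      (λ e∈ → let hi<t = proj₂ (∈-subset⁻ (U? ∩? hiBelow? t) e∈) in
              within-lo-hi (_< t) (≤-<-trans (m⊓n≤m⊔n _ _) hi<t) hi<t)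
      (λ e∈ → let ((_ , hi≮t) , lo≮t) = ∈-subset⁻ (above? t) e∈ in within-lo-hi (∁ (_< t)) lo≮t hi≮t)

    Near Far : ℕ → ℕ → Pred (Fin n) 0ℓ
    Near t s = Crossing t ∩ LoBelow s
    Far t s = Crossing t ∩ ∁ (LoBelow s)

    near? : ∀ t s → Decidable (Near t s)
    near? t s = crossing? t ∩? loBelow? s

    far? : ∀ t s → Decidable (Far t s)
    far? t s = crossing? t ∩? ∁? (loBelow? s)

    near-far-homogeneous : ∀ {ℓ} t s (Z : Pred ℕ ℓ) {p q : Subset n} →
      (∀ {e} → e ∈ p → Near t s e × Z (hi e)) → (∀ {e} → e ∈ q → Far t s e × ¬ Z (hi e)) →
      IsHomogeneousPair G p q
    near-far-homogeneous {ℓ} t s Z p⊆ q⊆ = within-homogeneous Side (near-within ∘ p⊆) (far-within ∘ q⊆)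
      where
      -- Lower ends of crossing edges are below t and are separated by s; upper ends are at least t
      -- and are separated by Z.
      Side : Pred ℕ ℓ
      Side v = v < s ⊎ (t ≤ v × Z v)

      near-within : ∀ {e} → Near t s e × Z (hi e) → Within Side e
      near-within ((((_ , hi≮t) , _) , lo<s) , Z-hi) =
        within-lo-hi Side (inj₁ lo<s) (inj₂ (≮⇒≥ hi≮t , Z-hi))

      far-within : ∀ {e} → Far t s e × ¬ Z (hi e) → Within (∁ Side) e
      far-within {e} (((_ , lo<t) , lo≮s) , ¬Z-hi) = within-lo-hi (∁ Side) lo∉Side hi∉Side
        where
        lo∉Side : ¬ Side (lo e)
        lo∉Side = [ lo≮s , (λ (t≤lo , _) → <⇒≱ lo<t t≤lo) ]′
        hi∉Side : ¬ Side (hi e)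
        hi∉Side = [ (λ hi<s → lo≮s (≤-<-trans (m⊓n≤m⊔n _ _) hi<s)) , ¬Z-hi ∘ proj₂ ]′

    module BoundedDegree (k : ℕ) (deg≤2k : ∀ v → ∣ star v ∣ ≤ 2 * k) where

      sweep-by-rank : {P : Pred (Fin n) ℓ} (P? : Decidable P) (rank : Fin n → ℕ) →
                      (∀ e → Incident (rank e) e) → {M : ℕ} (T : ℕ) →
                      (∀ {e} → P e → rank e < M) → T ≤ ∣ subset P? ∣ →
                      ∃[ t ] T ≤ ∣ below P? rank t ∣ × ∣ below P? rank t ∣ ≤ T + 2 * k
      sweep-by-rank P? rank rank-incident T = sweep P? rank T
        (λ v → ≤-trans (p⊆q⇒∣p∣≤∣q∣ (rank-fibre⊆star rank rank-incident v)) (deg≤2k v))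

      near-far-pair : ∀ t s → 4 * k ≤ ∣ subset (near? t s) ∣ → 2 * k ≤ ∣ subset (far? t s) ∣ →
                      HomogeneousPairOfSize G k
      near-far-pair t s 4k≤∣N∣ 2k≤∣F∣
        with sweep-by-rank (near? t s) hi hi-incident k (λ {e} _ → hi<m e) (≤-trans (m≤n*m k 4) 4k≤∣N∣)
      ... | r , k≤∣NL∣ , ∣NL∣≤3k with k ≤? ∣ subset (far? t s ∩? ∁? (hiBelow? r)) ∣
      ...   | yes k≤∣FH∣ = _ , _ ,
        near-far-homogeneous t s (_< r)
          (∈-subset⁻ (near? t s ∩? hiBelow? r)) (∈-subset⁻ (far? t s ∩? ∁? (hiBelow? r))) ,
        k≤∣NL∣ , k≤∣FH∣
      ...   | no k≰∣FH∣ = _ , _ ,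
        near-far-homogeneous t s (∁ (_< r)) (∈-subset⁻ (near? t s ∩? ∁? (hiBelow? r))) far-low ,
        ∣subset-∩∁∣-lower (near? t s) (hiBelow? r) (≤-trans (≤-reflexive (3k+k≡4k k)) 4k≤∣N∣) ∣NL∣≤3k ,
        ∣subset-∩∣-lower (far? t s) (hiBelow? r) (≤-trans (≤-reflexive (k+k≡2k k)) 2k≤∣F∣) (≰⇒≥ k≰∣FH∣)
        where
        far-low : ∀ {e} → e ∈ subset (far? t s ∩? hiBelow? r) → Far t s e × ¬ ¬ hi e < r
        far-low e∈ = let far , hi<r = ∈-subset⁻ (far? t s ∩? hiBelow? r) e∈ in far , λ hi≮r → hi≮r hi<r
        3k+k≡4k : ∀ k → k + 2 * k + k ≡ 4 * k
        3k+k≡4k = solve-∀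
        k+k≡2k : ∀ k → k + k ≡ 2 * k
        k+k≡2k = solve-∀

      crossing-pair : ∀ t → 8 * k ≤ ∣ subset (crossing? t) ∣ → HomogeneousPairOfSize G k
      crossing-pair t 8k≤∣C∣
        with sweep-by-rank (crossing? t) lo lo-incident (4 * k) proj₂
               (≤-trans (*-monoˡ-≤ k (m≤m+n 4 4)) 8k≤∣C∣)
      ... | s , 4k≤∣N∣ , ∣N∣≤6k = near-far-pair t s 4k≤∣N∣
        (∣subset-∩∁∣-lower (crossing? t) (loBelow? s) (≤-trans (≤-reflexive (6k+2k≡8k k)) 8k≤∣C∣) ∣N∣≤6k)
        where
        6k+2k≡8k : ∀ k → 4 * k + 2 * k + 2 * k ≡ 8 * k
        6k+2k≡8k = solve-∀

      pair-of-size : 12 * k ≤ n → HomogeneousPairOfSize G k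
      pair-of-size 12k≤n
        with sweep-by-rank U? hi hi-incident k (λ {e} _ → hi<m e)
               (≤-trans (m≤n*m k 12) (≤-trans 12k≤n (n≤∣subset∣ U? (λ _ → tt))))
      ... | t , k≤∣B∣ , ∣B∣≤3k with k ≤? ∣ subset (above? t) ∣
      ...   | yes k≤∣A∣ = _ , _ , below-above-homogeneous t , k≤∣B∣ , k≤∣A∣
      ...   | no k≰∣A∣ = crossing-pair t
        (∣subset-∩∣-lower (upper? t) (loBelow? t) (≤-trans (≤-reflexive (k+8k≡9k k)) 9k≤∣upper∣) (≰⇒≥ k≰∣A∣))
        where
        3k+9k≡12k : ∀ k → k + 2 * k + 9 * k ≡ 12 * k
        3k+9k≡12k = solve-∀
        k+8k≡9k : ∀ k → k + 8 * k ≡ 9 * k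
        k+8k≡9k = solve-∀
        9k≤∣upper∣ : 9 * k ≤ ∣ subset (upper? t) ∣
        9k≤∣upper∣ = ∣subset-∩∁∣-lower U? (hiBelow? t)
          (≤-trans (≤-reflexive (3k+9k≡12k k)) (≤-trans 12k≤n (n≤∣subset∣ U? (λ _ → tt)))) ∣B∣≤3k

    homogeneousPair-of-size : ∀ k → 12 * k ≤ n → HomogeneousPairOfSize G k
    homogeneousPair-of-size k 12k≤n with high-or-bounded-degree (2 * k)
    ... | inj₁ (v , 2k<deg) = star-pair k v 2k<deg
    ... | inj₂ deg≤2k = BoundedDegree.pair-of-size k deg≤2k 12k≤n

  singletons-homogeneous : ∀ {n} (G : SimpleGraph n) {i j : Fin n} → i ≢ j → IsHomogeneousPair G ⁅ i ⁆ ⁅ j ⁆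
  singletons-homogeneous G {i} {j} i≢j = disjoint , homogeneous
    where
    disjoint : ∀ x → x ∈ ⁅ i ⁆ → x ∈ ⁅ j ⁆ → ⊥
    disjoint x x∈i x∈j = i≢j (trans (sym (x∈⁅y⁆⇒x≡y i x∈i)) (x∈⁅y⁆⇒x≡y j x∈j))
    adj-constant : ∀ x y → x ∈ ⁅ i ⁆ → y ∈ ⁅ j ⁆ → adj G x y ≡ adj G i j
    adj-constant x y x∈i y∈j rewrite x∈⁅y⁆⇒x≡y i x∈i | x∈⁅y⁆⇒x≡y j y∈j = refl
    homogeneous : (∀ x y → x ∈ ⁅ i ⁆ → y ∈ ⁅ j ⁆ → adj G x y ≡ true) ⊎
                  (∀ x y → x ∈ ⁅ i ⁆ → y ∈ ⁅ j ⁆ → adj G x y ≡ false)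
    homogeneous with adj G i j in adj≡
    ... | true  = inj₁ λ x y x∈i y∈j → trans (adj-constant x y x∈i y∈j) adj≡
    ... | false = inj₂ λ x y x∈i y∈j → trans (adj-constant x y x∈i y∈j) adj≡

  two-singletons : ∀ {n} → 2 ≤ n → (G : SimpleGraph n) → HomogeneousPairOfSize G 1
  two-singletons {n} (s≤s (s≤s z≤n)) G =
    ⁅ i ⁆ , ⁅ j ⁆ , singletons-homogeneous G {i} {j} (λ ()) ,
    ≤-reflexive (sym (∣⁅x⁆∣≡1 {n} i)) , ≤-reflexive (sym (∣⁅x⁆∣≡1 {n} j))
    where
    i j : Fin n
    i = Fin.zero
    j = Fin.suc Fin.zero

  linear-homogeneousPair : ∀ {n} → 2 ≤ n → (G : SimpleGraph n) → IsLineGraph G →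
    ∃[ P ] ∃[ Q ] IsHomogeneousPair G P Q × n ≤ 24 * ∣ P ∣ × n ≤ 24 * ∣ Q ∣
  linear-homogeneousPair {n} 2≤n G (_ , H , isLine) with n / 12 in n/12≡k
  ... | zero =
    let P , Q , homogeneous , 1≤∣P∣ , 1≤∣Q∣ = two-singletons 2≤n G
    in  P , Q , homogeneous , n≤24* 1≤∣P∣ , n≤24* 1≤∣Q∣
    where
    n≤24* : ∀ {x} → 1 ≤ x → n ≤ 24 * x
    n≤24* 1≤x = ≤-trans (≤-trans (<⇒≤ (m/n≡0⇒m<n n/12≡k)) (m≤m+n 12 12)) (*-monoʳ-≤ 24 1≤x)
  ... | suc k′ =
    let P , Q , homogeneous , k≤∣P∣ , k≤∣Q∣ = LineGraph.homogeneousPair-of-size H G isLine k 12k≤n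
    in  P , Q , homogeneous , n≤24* k≤∣P∣ , n≤24* k≤∣Q∣
    where
    k = suc k′
    [n/12]*12≡12k : n / 12 * 12 ≡ 12 * k
    [n/12]*12≡12k = trans (cong (_* 12) n/12≡k) (*-comm k 12)
    12k≤n : 12 * k ≤ n
    12k≤n = subst (_≤ n) [n/12]*12≡12k (m/n*n≤m n 12)
    n<12+12k : n < 12 + 12 * k
    n<12+12k = subst₂ _<_ (sym (m≡m%n+[m/n]*n n 12)) (cong (_+_ 12) [n/12]*12≡12k)
      (+-monoˡ-< (n / 12 * 12) (m%n<n n 12))
    24k≡12+12k+12k′ : ∀ k′ → 24 * suc k′ ≡ 12 + 12 * suc k′ + 12 * k′
    24k≡12+12k+12k′ = solve-∀
    n≤24* : ∀ {x} → k ≤ x → n ≤ 24 * x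
    n≤24* k≤x = ≤-trans (<⇒≤ n<12+12k)
      (≤-trans (subst (12 + 12 * k ≤_) (sym (24k≡12+12k+12k′ k′)) (m≤m+n _ _)) (*-monoʳ-≤ 24 k≤x))

  0<1/24 : ℚ.0ℚ ℚ.< + 1 ℚ./ 24
  0<1/24 = ℚₚ.toℚᵘ-cancel-< (ℚᵘ.*<* (ℤ.+<+ (s≤s z≤n)))

  toℚᵘ-n/1 : ∀ n → ℚ.toℚᵘ (+ n ℚ./ 1) ℚᵘ.≃ ℚᵘ.mkℚᵘ (+ n) 0
  toℚᵘ-n/1 n = ℚₚ.toℚᵘ-fromℚᵘ (ℚᵘ.mkℚᵘ (+ n) 0)

  n≤24k⇒n/24≤k : ∀ n k → n ≤ 24 * k → + 1 ℚ./ 24 ℚ.* (+ n ℚ./ 1) ℚ.≤ + k ℚ./ 1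
  n≤24k⇒n/24≤k n k n≤24k = ℚₚ.toℚᵘ-cancel-≤
    (ℚᵘₚ.≤-respˡ-≃ (ℚᵘₚ.≃-sym (ℚᵘₚ.≃-trans (ℚₚ.toℚᵘ-homo-* (+ 1 ℚ./ 24) (+ n ℚ./ 1))
                                          (ℚᵘₚ.*-congˡ {ℚ.toℚᵘ (+ 1 ℚ./ 24)} (toℚᵘ-n/1 n))))
     (ℚᵘₚ.≤-respʳ-≃ (ℚᵘₚ.≃-sym (toℚᵘ-n/1 k)) (ℚᵘ.*≤* cross-multiplied)))
    where
    cross-multiplied : (+ 1 ℤ.* + n) ℤ.* + 1 ℤ.≤ + k ℤ.* + 24
    cross-multiplied rewrite ℤₚ.*-identityˡ (+ n) | ℤₚ.*-identityʳ (+ n) | ℤₚ.+◃n≡+n (k * 24) =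
      ℤ.+≤+ (subst (n ≤_) (*-comm 24 k) n≤24k)

open import Defs
open import Data.Nat as ℕ using (ℕ)
open import Data.Integer using (+_)
open import Data.Rational using (ℚ; 0ℚ; _*_; _/_; _≤_; _<_)
open import Data.Fin.Subset using (Subset; ∣_∣)
open import Data.Product using (_×_; Σ; _,_)
open HomogeneousPairs using (0<1/24; n≤24k⇒n/24≤k; linear-homogeneousPair)

theorem1p6 : Σ ℚ λ δ → (0ℚ < δ) ×
    (∀ (n : ℕ) → 2 ℕ.≤ n → (G : SimpleGraph n) → IsLineGraph G →
      Σ (Subset n) λ P → Σ (Subset n) λ Q → IsHomogeneousPair G P Q ×
        (δ * (+ n / 1) ≤ + ∣ P ∣ / 1) × (δ * (+ n / 1) ≤ + ∣ Q ∣ / 1))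
theorem1p6 = + 1 / 24 , 0<1/24 , λ n 2≤n G isLine →
  let P , Q , homogeneous , n≤24∣P∣ , n≤24∣Q∣ = linear-homogeneousPair 2≤n G isLine
  in P , Q , homogeneous , n≤24k⇒n/24≤k n (∣ P ∣) n≤24∣P∣ , n≤24k⇒n/24≤k n (∣ Q ∣) n≤24∣Q∣
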